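{- Let $\mathcal{M}=\langle S,N,V\rangle$ be a $c$-model. Then for all $\phi\in\mathcal{L}_\Delta$ and all $s\in S$, $\mathcal{M},s\Vvdash\phi$ iff $\mathcal{M},s\Vdash\phi$.
   Context: $\mathcal{L}_\Delta$: $\phi::=p\mid\neg\phi\mid(\phi\land\phi)\mid\Delta\phi$. A neighborhood model is $\langle S,N,V\rangle$, $S\neq\emptyset$, $N:S\to 2^{2^S}$, $V$ a valuation; it is a $c$-model if for all $s$, $X\in N(s)$ implies $S\setminus X\in N(s)$. Both semantics: $s$ satisfies $p$ iff $s\in V(p)$, Boolean clauses standard. New semantics: $\mathcal{M},s\Vvdash\Delta\phi$ iff $\{t:\mathcal{M},t\Vvdash\phi\}\in N(s)$. Old semantics: $\mathcal{M},s\Vdash\Delta\phi$ iff $\{t:\mathcal{M},t\Vdash\phi\}\in N(s)$ or $\{t:\mathcal{M},t\Vdash\neg\phi\}\in N(s)$. -}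

module Defs where

open import Data.Bool using (Bool; true; false; not; _∧_; _∨_)
open import Data.Nat using (ℕ)
open import Relation.Binary.PropositionalEquality using (_≡_)

data Form : Set where
  var : ℕ → Form
  ¬'_ : Form → Form
  _∧'_ : Form → Form → Form
  Δ_  : Form → Form

Subset : Set → Set
Subset S = S → Bool

-- Since subsets are represented by functions, N must respect pointwise
-- equality of characteristic functions (i.e. N(s) is a set of SUBSETS).
record NbhdModel : Set₁ where
  field
    S      : Set
    point  : S                       -- S ≠ ∅
    N      : S → Subset S → Bool
    N-ext  : ∀ s (X Y : Subset S) → (∀ t → X t ≡ Y t) → N s X ≡ N s Y
    V      : ℕ → Subset S

open NbhdModel public

compl : {S : Set} → Subset S → Subset S
compl X t = not (X t)

IsCModel : NbhdModel → Set
IsCModel M = ∀ s (X : Subset (S M)) → N M s X ≡ true → N M s (compl X) ≡ true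

-- New semantics (⊩⊩): M,s ⊩⊩ Δφ iff ⟦φ⟧ ∈ N(s)
satNew : (M : NbhdModel) → Form → Subset (S M)
satNew M (var p)   s = V M p s
satNew M (¬' φ)    s = not (satNew M φ s)
satNew M (φ ∧' ψ)  s = satNew M φ s ∧ satNew M ψ s
satNew M (Δ φ)     s = N M s (satNew M φ)

-- Old semantics (⊩): M,s ⊩ Δφ iff ⟦φ⟧ ∈ N(s) or ⟦¬φ⟧ ∈ N(s)
satOld : (M : NbhdModel) → Form → Subset (S M)
satOld M (var p)   s = V M p s
satOld M (¬' φ)    s = not (satOld M φ s)
satOld M (φ ∧' ψ)  s = satOld M φ s ∧ satOld M ψ s
satOld M (Δ φ)     s = N M s (satOld M φ) ∨ N M s (compl (satOld M φ))   -- ⟦¬φ⟧ = S \ ⟦φ⟧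

-- In a c-model, X ∈ N(s) iff S \ X ∈ N(s), so the old disjunctive clause
-- "⟦φ⟧ ∈ N(s) or ⟦¬φ⟧ ∈ N(s)" collapses to its first disjunct; an induction
-- on φ then shows that both semantics assign every formula the same truth set.
module Submission where

open import Defs
open import Data.Bool using (true; false; not; _∧_; _∨_)
open import Data.Bool.Properties using (not-involutive)
open import Relation.Binary.PropositionalEquality using (_≡_; refl; sym; trans; cong; cong₂)
open import Function.Bundles using (_⇔_; mk⇔)

∨-absorbs-implied : ∀ x y → (y ≡ true → x ≡ true) → x ∨ y ≡ x
∨-absorbs-implied true  _     _     = refl
∨-absorbs-implied false false _     = refl
∨-absorbs-implied false true  y⇒x = sym (y⇒x refl)

module _ (M : NbhdModel) (isC : IsCModel M) where

  compl∈N⇒∈N : ∀ s (X : Subset (S M)) → N M s (compl X) ≡ true → N M s X ≡ true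
  compl∈N⇒∈N s X Xᶜ∈N =
    trans (N-ext M s X (compl (compl X)) (λ t → sym (not-involutive (X t))))
          (isC s (compl X) Xᶜ∈N)

  N-or-compl≡N : ∀ s (X : Subset (S M)) → N M s X ∨ N M s (compl X) ≡ N M s X
  N-or-compl≡N s X = ∨-absorbs-implied (N M s X) (N M s (compl X)) (compl∈N⇒∈N s X)

  satNew≡satOld : ∀ φ s → satNew M φ s ≡ satOld M φ s
  satNew≡satOld (var p)  s = refl
  satNew≡satOld (¬' φ)   s = cong not (satNew≡satOld φ s)
  satNew≡satOld (φ ∧' ψ) s = cong₂ _∧_ (satNew≡satOld φ s) (satNew≡satOld ψ s)
  satNew≡satOld (Δ φ)    s =
    trans (N-ext M s (satNew M φ) (satOld M φ) (satNew≡satOld φ))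
          (sym (N-or-compl≡N s (satOld M φ)))

proposition2 : (M : NbhdModel) → IsCModel M →
    ∀ (φ : Form) (s : S M) → (satNew M φ s ≡ true) ⇔ (satOld M φ s ≡ true)
proposition2 M isC φ s = mk⇔ (trans (sym same)) (trans same)
  where
  same : satNew M φ s ≡ satOld M φ s
  same = satNew≡satOld M isC φ s
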